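{- Let $T\subset\mathbb{R}^3$ be the truncated unit cube obtained from $[0,1]^3$ by cutting off each corner so that the new vertices lie at $1/3$ and $2/3$ of the way along the edges of the cube, i.e. $T=\{x\in[0,1]^3: \sum_{i=1}^3|x_i-v_i|\ge 1/3 \text{ for every } v\in\{0,1\}^3\}$. For a positive integer $s$ let $i(s)=\#(sT\cap\mathbb{Z}^3)$. Then $$i(s)=\begin{cases}\frac{77s^3}{81}+\frac{23s^2}{9}+\frac{19s}{9}+1 & \text{if } s\equiv0\pmod 3,\\[2pt] \frac{77s^3}{81}+\frac{61s^2}{27}-\frac{7s}{27}-\frac{239}{81} & \text{if } s\equiv1\pmod 3,\\[2pt] \frac{77s^3}{81}+\frac{65s^2}{27}+\frac{29s}{27}-\frac{31}{81} & \text{if } s\equiv2\pmod 3.\end{cases}$$ -}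

module Defs where

open import Data.Nat using (ℕ; _∸_; _*_; _+_; _≤ᵇ_; suc)
open import Data.Bool using (Bool; true; false; if_then_else_; _∧_)
open import Data.List using (List; []; _∷_; length; filterᵇ; upTo; concatMap; map; foldr)
open import Data.Product using (_×_; _,_)
open import Data.Integer using (+_)
open import Data.Rational using (ℚ; _/_)

-- |a - s·b| for a ∈ {0..s} and a corner coordinate b ∈ {0,1}
coordDist : ℕ → Bool → ℕ → ℕ
coordDist s b a = if b then s ∸ a else a

Point : Set
Point = ℕ × ℕ × ℕ

Corner : Set
Corner = Bool × Bool × Bool

corners : List Corner
corners = concatMap (λ a → concatMap (λ b → map (λ c → (a , b , c)) (true ∷ false ∷ [])) (true ∷ false ∷ [])) (true ∷ false ∷ [])

dist : ℕ → Corner → Point → ℕ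
dist s (a , b , c) (x , y , z) = coordDist s a x + coordDist s b y + coordDist s c z

-- x ∈ sT  (for x ∈ {0..s}^3):  for every vertex v, Σ|x_i - s v_i| ≥ s/3,
-- i.e. s ≤ 3 · Σ|x_i - s v_i|
inST : ℕ → Point → Bool
inST s p = foldr (λ v r → (s ≤ᵇ 3 * dist s v p) ∧ r) true corners

cubePoints : ℕ → List Point
cubePoints s = concatMap (λ x → concatMap (λ y → map (λ z → (x , y , z)) (upTo (suc s))) (upTo (suc s))) (upTo (suc s))

latticeCount : ℕ → ℕ
latticeCount s = length (filterᵇ (inST s) (cubePoints s))

ℕtoℚ : ℕ → ℚ
ℕtoℚ n = (+ n) / 1

{-# OPTIONS --safe #-}
module Submission where

-- A lattice point of s[0,1]³ lies outside sT exactly when its ℓ¹-distance to some vertex s·v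
-- is below s/3. On the cube the distances to two distinct vertices add up to at least s, so at
-- most one vertex is that close, and the reflections x ↦ s − x carry each of the eight cut-off
-- corners onto the one at the origin. Writing s = r + 3k with r ∈ {1, 2, 3}, that corner is the
-- simplex x + y + z ≤ k, with C(k+3, 3) lattice points. Hence
--   i(s) = (s+1)³ − 8·C(k+3, 3) = (s+1)³ − (4/81)·m(m+3)(m+6),   m = 3(k+1) = s + 3 − r,
-- and expanding this in each residue class gives the three polynomials.

open import Defs
open import Data.Nat using (ℕ; _%_; _≥_)
open import Data.Product using (_×_)
open import Relation.Binary.PropositionalEquality using (_≡_)

module LatticePointCount where

  open import Data.Bool using (Bool; true; false; not; _∨_; T; T?)
  open import Data.Bool.ListAction using (all)
  open import Data.Bool.Properties using (T-∨) renaming (_≟_ to _≟ᵇ_)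
  open import Data.List using (List; []; _∷_; map; upTo; applyUpTo; concatMap; filterᵇ; length)
  open import Data.List.Properties using (filter-++; length-++)
  open import Data.List.Relation.Unary.All using (All; []; _∷_)
  open import Data.List.Relation.Unary.AllPairs as AllPairs using (AllPairs; []; _∷_)
  open import Data.Nat using (zero; suc; _+_; _*_; _∸_; _^_; _≤_; _<_; _≤ᵇ_; s≤s; z<s; s<s)
  open import Data.Nat.DivMod using ([m+kn]%n≡m%n)
  open import Data.Nat.ListAction using (sum)
  open import Data.Nat.Properties
  open import Algebra.Properties.CommutativeSemigroup +-commutativeSemigroup using (interchange)
  open import Data.Nat.Tactic.RingSolver using (solve-∀)
  open import Data.Product using (_,_)
  open import Data.Product.Properties using (≡-dec)
  open import Data.Sum as Sum using (_⊎_; inj₁; inj₂)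
  open import Function using (_∘_; id; Equivalence)
  open import Relation.Binary.Definitions using (DecidableEquality)
  open import Relation.Binary.PropositionalEquality
    using (_≢_; refl; sym; trans; cong; cong₂; module ≡-Reasoning)
  open import Relation.Nullary using (yes; no; contradiction)
  open import Relation.Nullary.Decidable using (from-yes)
  open import Relation.Nullary.Reflects using (det; ¬-reflects; fromEquivalence)

  𝟙 : Bool → ℕ
  𝟙 true  = 1
  𝟙 false = 0

  ∑< : ℕ → (ℕ → ℕ) → ℕ
  ∑< zero    f = 0
  ∑< (suc n) f = f 0 + ∑< n (f ∘ suc)

  syntax ∑< n (λ i → e) = ∑[ i < n ] e

  ∑-cong : ∀ n {f g : ℕ → ℕ} → (∀ {i} → i < n → f i ≡ g i) → ∑< n f ≡ ∑< n g
  ∑-cong zero    f≗g = refl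
  ∑-cong (suc n) f≗g = cong₂ _+_ (f≗g z<s) (∑-cong n (f≗g ∘ s<s))

  ∑-const : ∀ n c → ∑[ _ < n ] c ≡ n * c
  ∑-const zero    c = refl
  ∑-const (suc n) c = cong (c +_) (∑-const n c)

  ∑-zero : ∀ n {f} → (∀ {i} → i < n → f i ≡ 0) → ∑< n f ≡ 0
  ∑-zero n f≗0 = trans (∑-cong n f≗0) (trans (∑-const n 0) (*-zeroʳ n))

  ∑-distrib-+ : ∀ n (f g : ℕ → ℕ) → ∑[ i < n ] (f i + g i) ≡ ∑< n f + ∑< n g
  ∑-distrib-+ zero    f g = refl
  ∑-distrib-+ (suc n) f g =
    trans (cong (f 0 + g 0 +_) (∑-distrib-+ n (f ∘ suc) (g ∘ suc))) (interchange (f 0) (g 0) _ _)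

  ∑-snoc : ∀ n f → ∑< (suc n) f ≡ ∑< n f + f n
  ∑-snoc zero    f = +-comm (f 0) 0
  ∑-snoc (suc n) f = trans (cong (f 0 +_) (∑-snoc n (f ∘ suc))) (sym (+-assoc (f 0) _ _))

  ∑-reverse : ∀ s f → ∑[ x < suc s ] f (s ∸ x) ≡ ∑< (suc s) f
  ∑-reverse zero    f = refl
  ∑-reverse (suc s) f = begin
    f (suc s) + ∑[ x < suc s ] f (s ∸ x) ≡⟨ cong (f (suc s) +_) (∑-reverse s f) ⟩
    f (suc s) + ∑< (suc s) f             ≡⟨ +-comm (f (suc s)) _ ⟩
    ∑< (suc s) f + f (suc s)             ≡⟨ ∑-snoc (suc s) f ⟨
    ∑< (suc (suc s)) f                   ∎
    where open ≡-Reasoning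

  ∑₁ : ℕ → (ℕ → ℕ) → ℕ
  ∑₁ zero    g = 0
  ∑₁ (suc m) g = g (suc m) + ∑₁ m g

  ∑-∸ : ∀ {g} → g 0 ≡ 0 → ∀ {m} n → m ≤ n → ∑[ x < n ] g (m ∸ x) ≡ ∑₁ m g
  ∑-∸ {g} g0≡0 {zero}  n       _         = ∑-zero n (λ {x} _ → trans (cong g (0∸n≡0 x)) g0≡0)
  ∑-∸ {g} g0≡0 {suc m} (suc n) (s≤s m≤n) = cong (g (suc m) +_) (∑-∸ g0≡0 n m≤n)

  ∑³ : ℕ → (ℕ → ℕ → ℕ → ℕ) → ℕ
  ∑³ n F = ∑[ x < n ] ∑[ y < n ] ∑[ z < n ] F x y z

  ∑³-cong : ∀ n {F G : ℕ → ℕ → ℕ → ℕ} →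
            (∀ {x y z} → x < n → y < n → z < n → F x y z ≡ G x y z) → ∑³ n F ≡ ∑³ n G
  ∑³-cong n F≗G = ∑-cong n λ x<n → ∑-cong n λ y<n → ∑-cong n λ z<n → F≗G x<n y<n z<n

  ∑³-const : ∀ n c → ∑³ n (λ _ _ _ → c) ≡ n * (n * (n * c))
  ∑³-const n c =
    trans (∑-cong n λ _ → trans (∑-cong n λ _ → ∑-const n c) (∑-const n _)) (∑-const n _)

  ∑³-zero : ∀ n → ∑³ n (λ _ _ _ → 0) ≡ 0
  ∑³-zero n = ∑-zero n λ _ → ∑-zero n λ _ → ∑-zero n λ _ → refl

  ∑³-distrib-+ : ∀ n (F G : ℕ → ℕ → ℕ → ℕ) →
                 ∑³ n (λ x y z → F x y z + G x y z) ≡ ∑³ n F + ∑³ n G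
  ∑³-distrib-+ n F G = trans
    (∑-cong n λ _ → trans (∑-cong n λ _ → ∑-distrib-+ n _ _) (∑-distrib-+ n _ _))
    (∑-distrib-+ n _ _)

  ∑³-sum : ∀ {A : Set} n (F : A → ℕ → ℕ → ℕ → ℕ) vs →
           ∑³ n (λ x y z → sum (map (λ v → F v x y z) vs)) ≡ sum (map (λ v → ∑³ n (F v)) vs)
  ∑³-sum n F []       = ∑³-zero n
  ∑³-sum n F (v ∷ vs) = trans (∑³-distrib-+ n (F v) _) (cong (∑³ n (F v) +_) (∑³-sum n F vs))

  sum-map-const : ∀ {A : Set} {F : A → ℕ} {c} → (∀ v → F v ≡ c) →
                  ∀ vs → sum (map F vs) ≡ length vs * c
  sum-map-const F≗c []       = refl
  sum-map-const F≗c (v ∷ vs) = cong₂ _+_ (F≗c v) (sum-map-const F≗c vs)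

  count-concatMap : ∀ {A : Set} (P : A → Bool) (g : ℕ → List A) f n →
    length (filterᵇ P (concatMap g (applyUpTo f n))) ≡ ∑[ i < n ] length (filterᵇ P (g (f i)))
  count-concatMap P g f zero    = refl
  count-concatMap P g f (suc n) = trans
    (cong length (filter-++ (T? ∘ P) (g (f 0)) _))
    (trans (length-++ (filterᵇ P (g (f 0)))) (cong (_ +_) (count-concatMap P g (f ∘ suc) n)))

  count-map : ∀ {A : Set} (P : A → Bool) (h : ℕ → A) f n →
    length (filterᵇ P (map h (applyUpTo f n))) ≡ ∑[ i < n ] 𝟙 (P (h (f i)))
  count-map P h f zero    = refl
  count-map P h f (suc n) with P (h (f 0))
  ... | true  = cong suc (count-map P h (f ∘ suc) n)
  ... | false = count-map P h (f ∘ suc) n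

  latticeCount≡∑³ : ∀ s → latticeCount s ≡ ∑³ (suc s) (λ x y z → 𝟙 (inST s (x , y , z)))
  latticeCount≡∑³ s =
    trans (count-concatMap (inST s) plane id n) (∑-cong n λ {x} _ →
      trans (count-concatMap (inST s) (line x) id n) (∑-cong n λ {y} _ →
        count-map (inST s) (λ z → (x , y , z)) id n))
    where
    n = suc s
    line : ℕ → ℕ → List Point
    line x y = map (λ z → (x , y , z)) (upTo n)
    plane : ℕ → List Point
    plane x = concatMap (line x) (upTo n)

  ≤ᵇ-suc : ∀ m n → (suc m ≤ᵇ suc n) ≡ (m ≤ᵇ n)
  ≤ᵇ-suc zero    n = refl
  ≤ᵇ-suc (suc m) n = refl

  ∑-𝟙≤ᵇ : ∀ n c k → k < c + n → ∑[ z < n ] 𝟙 (c + z ≤ᵇ k) ≡ suc k ∸ c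
  ∑-𝟙≤ᵇ (suc n) zero    k       k<n   = cong suc (∑-𝟙≤ᵇ n 1 k k<n)
  ∑-𝟙≤ᵇ n       (suc c) zero    _     = trans (∑-zero n (λ _ → refl)) (sym (0∸n≡0 c))
  ∑-𝟙≤ᵇ n       (suc c) (suc k) k<c+n =
    trans (∑-cong n (λ {z} _ → cong 𝟙 (≤ᵇ-suc (c + z) k))) (∑-𝟙≤ᵇ n c k (≤-pred k<c+n))

  triangular tetrahedral : ℕ → ℕ
  triangular  m = ∑₁ m id
  tetrahedral m = ∑₁ m triangular

  simplex-count : ∀ {n k} → k < n → ∑³ n (λ x y z → 𝟙 (x + y + z ≤ᵇ k)) ≡ tetrahedral (suc k)
  simplex-count {n} {k} k<n = begin
    ∑³ n (λ x y z → 𝟙 (x + y + z ≤ᵇ k))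
      ≡⟨ ∑-cong n (λ {x} _ → ∑-cong n λ {y} _ →
           trans (∑-𝟙≤ᵇ n (x + y) k (<-≤-trans k<n (m≤n+m n _))) (sym (∸-+-assoc (suc k) x y))) ⟩
    ∑[ x < n ] ∑[ y < n ] (suc k ∸ x ∸ y)
      ≡⟨ ∑-cong n (λ {x} _ → ∑-∸ {id} refl n (≤-trans (m∸n≤m (suc k) x) k<n)) ⟩
    ∑[ x < n ] triangular (suc k ∸ x)
      ≡⟨ ∑-∸ {triangular} refl n k<n ⟩
    tetrahedral (suc k) ∎
    where open ≡-Reasoning

  triangular-closed : ∀ m → 2 * triangular m ≡ m * suc m
  triangular-closed zero    = refl
  triangular-closed (suc m) = begin
    2 * (suc m + triangular m)   ≡⟨ *-distribˡ-+ 2 (suc m) (triangular m) ⟩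
    2 * suc m + 2 * triangular m ≡⟨ cong (2 * suc m +_) (triangular-closed m) ⟩
    2 * suc m + m * suc m        ≡⟨ step m ⟩
    suc m * suc (suc m)          ∎
    where
    open ≡-Reasoning
    step : ∀ m → 2 * suc m + m * suc m ≡ suc m * suc (suc m)
    step = solve-∀

  tetrahedral-closed : ∀ m → 6 * tetrahedral m ≡ m * suc m * suc (suc m)
  tetrahedral-closed zero    = refl
  tetrahedral-closed (suc m) = begin
    6 * (triangular (suc m) + tetrahedral m)
      ≡⟨ *-distribˡ-+ 6 (triangular (suc m)) (tetrahedral m) ⟩
    6 * triangular (suc m) + 6 * tetrahedral m
      ≡⟨ cong (_+ 6 * tetrahedral m) (*-assoc 3 2 (triangular (suc m))) ⟩
    3 * (2 * triangular (suc m)) + 6 * tetrahedral m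
      ≡⟨ cong₂ (λ a b → 3 * a + b) (triangular-closed (suc m)) (tetrahedral-closed m) ⟩
    3 * (suc m * suc (suc m)) + m * suc m * suc (suc m)
      ≡⟨ step m ⟩
    suc m * suc (suc m) * suc (suc (suc m)) ∎
    where
    open ≡-Reasoning
    step : ∀ m → 3 * (suc m * suc (suc m)) + m * suc m * suc (suc m)
                 ≡ suc m * suc (suc m) * suc (suc (suc m))
    step = solve-∀

  tetrahedral-scaled : ∀ k → let m = 3 * suc k in
                       4 * (m * (m + 3) * (m + 6)) ≡ 81 * (8 * tetrahedral (suc k))
  tetrahedral-scaled k = begin
    4 * (3 * suc k * (3 * suc k + 3) * (3 * suc k + 6)) ≡⟨ step k ⟩
    108 * (suc k * suc (suc k) * suc (suc (suc k)))     ≡⟨ cong (108 *_) (tetrahedral-closed (suc k)) ⟨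
    108 * (6 * tetrahedral (suc k))                      ≡⟨ *-assoc 108 6 (tetrahedral (suc k)) ⟨
    648 * tetrahedral (suc k)                            ≡⟨ *-assoc 81 8 (tetrahedral (suc k)) ⟩
    81 * (8 * tetrahedral (suc k))                       ∎
    where
    open ≡-Reasoning
    step : ∀ k → 4 * (3 * suc k * (3 * suc k + 3) * (3 * suc k + 6))
                 ≡ 108 * (suc k * suc (suc k) * suc (suc (suc k)))
    step = solve-∀

  farFrom : ℕ → Point → Corner → Bool
  farFrom s p v = s ≤ᵇ 3 * dist s v p

  cutCorners : ℕ → Point → ℕ
  cutCorners s p = sum (map (𝟙 ∘ not ∘ farFrom s p) corners)

  coordDist-apart : ∀ {s x} a b → a ≢ b → x ≤ s → s ≤ coordDist s a x + coordDist s b x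
  coordDist-apart true  true  a≢b _   = contradiction refl a≢b
  coordDist-apart true  false _   x≤s = ≤-reflexive (sym (m∸n+n≡m x≤s))
  coordDist-apart false true  _   x≤s = ≤-reflexive (sym (m+[n∸m]≡n x≤s))
  coordDist-apart false false a≢b _   = contradiction refl a≢b

  dist-apart : ∀ {s x y z} → x ≤ s → y ≤ s → z ≤ s → ∀ v w → v ≢ w →
               s ≤ dist s v (x , y , z) + dist s w (x , y , z)
  dist-apart {s} {x} {y} {z} x≤s y≤s z≤s (a , b , c) (a′ , b′ , c′) v≢w =
    ≤-trans apart (≤-reflexive (regroup (cd a x) (cd b y) (cd c z) (cd a′ x) (cd b′ y) (cd c′ z)))
    where
    cd = coordDist s
    regroup : ∀ A B C A′ B′ C′ → (A + A′) + (B + B′) + (C + C′) ≡ (A + B + C) + (A′ + B′ + C′)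
    regroup = solve-∀
    apart : s ≤ (cd a x + cd a′ x) + (cd b y + cd b′ y) + (cd c z + cd c′ z)
    apart with a ≟ᵇ a′ | b ≟ᵇ b′ | c ≟ᵇ c′
    ... | no a≢a′  | _        | _        =
      ≤-trans (coordDist-apart a a′ a≢a′ x≤s)
              (≤-trans (m≤m+n _ (cd b y + cd b′ y)) (m≤m+n _ (cd c z + cd c′ z)))
    ... | yes refl | no b≢b′  | _        =
      ≤-trans (coordDist-apart b b′ b≢b′ y≤s)
              (≤-trans (m≤n+m _ (cd a x + cd a x)) (m≤m+n _ (cd c z + cd c′ z)))
    ... | yes refl | yes refl | no c≢c′  =
      ≤-trans (coordDist-apart c c′ c≢c′ z≤s)
              (m≤n+m _ (cd a x + cd a x + (cd b y + cd b y)))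
    ... | yes refl | yes refl | yes refl = contradiction refl v≢w

  s≤a+b⇒s≤a+a⊎s≤b+b : ∀ {s} a b → s ≤ a + b → s ≤ a + a ⊎ s ≤ b + b
  s≤a+b⇒s≤a+a⊎s≤b+b a b s≤a+b with ≤-total a b
  ... | inj₁ a≤b = inj₂ (≤-trans s≤a+b (+-monoˡ-≤ b a≤b))
  ... | inj₂ b≤a = inj₁ (≤-trans s≤a+b (+-monoʳ-≤ a b≤a))

  farFrom-either : ∀ {s x y z} → x ≤ s → y ≤ s → z ≤ s → ∀ {v w} → v ≢ w →
                   T (farFrom s (x , y , z) v ∨ farFrom s (x , y , z) w)
  farFrom-either {s} {x} {y} {z} x≤s y≤s z≤s {v} {w} v≢w =
    Equivalence.from T-∨ (Sum.map (≤⇒≤ᵇ ∘ ≤3* dv) (≤⇒≤ᵇ ∘ ≤3* dw)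
      (s≤a+b⇒s≤a+a⊎s≤b+b dv dw (dist-apart x≤s y≤s z≤s v w v≢w)))
    where
    dv = dist s v (x , y , z)
    dw = dist s w (x , y , z)
    ≤3* : ∀ d → s ≤ d + d → s ≤ 3 * d
    ≤3* d s≤d+d = ≤-trans s≤d+d (+-monoʳ-≤ d (m≤m+n d (d + 0)))

  module _ {A : Set} (g : A → Bool) where

    ∑-not≡0 : ∀ {xs} → All (T ∘ g) xs → sum (map (𝟙 ∘ not ∘ g) xs) ≡ 0
    ∑-not≡0 {[]}     []         = refl
    ∑-not≡0 {x ∷ xs} (gx ∷ gxs) with g x
    ... | true = ∑-not≡0 gxs

    𝟙-all+∑-not≡1 : ∀ {xs} → AllPairs (λ v w → T (g v ∨ g w)) xs →
                    𝟙 (all g xs) + sum (map (𝟙 ∘ not ∘ g) xs) ≡ 1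
    𝟙-all+∑-not≡1 {[]}     []             = refl
    𝟙-all+∑-not≡1 {x ∷ xs} (gx∨g ∷ pairs) with g x
    ... | true  = 𝟙-all+∑-not≡1 pairs
    ... | false = cong suc (∑-not≡0 gx∨g)

  _≟ᶜ_ : DecidableEquality Corner
  _≟ᶜ_ = ≡-dec _≟ᵇ_ (≡-dec _≟ᵇ_ _≟ᵇ_)

  open import Data.List.Relation.Unary.Unique.DecPropositional _≟ᶜ_ using (Unique; unique?)

  corners-unique : Unique corners
  corners-unique = from-yes (unique? corners)

  inST+cutCorners≡1 : ∀ {s x y z} → x ≤ s → y ≤ s → z ≤ s →
                      𝟙 (inST s (x , y , z)) + cutCorners s (x , y , z) ≡ 1
  inST+cutCorners≡1 {s} {x} {y} {z} x≤s y≤s z≤s =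
    𝟙-all+∑-not≡1 (farFrom s (x , y , z)) (AllPairs.map (farFrom-either x≤s y≤s z≤s) corners-unique)

  ∑-coordDist : ∀ s b f → ∑[ x < suc s ] f (coordDist s b x) ≡ ∑< (suc s) f
  ∑-coordDist s true  f = ∑-reverse s f
  ∑-coordDist s false f = refl

  ∑³-dist : ∀ s (h : ℕ → ℕ) v →
            ∑³ (suc s) (λ x y z → h (dist s v (x , y , z))) ≡ ∑³ (suc s) (λ x y z → h (x + y + z))
  ∑³-dist s h (a , b , c) =
    trans (∑-coordDist s a λ x → ∑[ y < n ] ∑[ z < n ] h (x + cd b y + cd c z)) (∑-cong n λ {x} _ →
      trans (∑-coordDist s b λ y → ∑[ z < n ] h (x + y + cd c z)) (∑-cong n λ {y} _ →
        ∑-coordDist s c λ z → h (x + y + z)))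
    where
    n = suc s
    cd = coordDist s

  latticeCount+cuts : ∀ s →
    latticeCount s + 8 * ∑³ (suc s) (λ x y z → 𝟙 (not (s ≤ᵇ 3 * (x + y + z)))) ≡ suc s ^ 3
  latticeCount+cuts s = begin
    latticeCount s + 8 * ∑³ n (λ x y z → cut (x + y + z))
      ≡⟨ cong₂ _+_ (latticeCount≡∑³ s) (sym (sum-map-const (∑³-dist s cut) corners)) ⟩
    ∑³ n inside + sum (map (λ v → ∑³ n (cutAt v)) corners)
      ≡⟨ cong (∑³ n inside +_) (∑³-sum n cutAt corners) ⟨
    ∑³ n inside + ∑³ n cuts
      ≡⟨ ∑³-distrib-+ n inside cuts ⟨
    ∑³ n (λ x y z → inside x y z + cuts x y z)
      ≡⟨ ∑³-cong n (λ x<n y<n z<n → inST+cutCorners≡1 (≤-pred x<n) (≤-pred y<n) (≤-pred z<n)) ⟩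
    ∑³ n (λ _ _ _ → 1)
      ≡⟨ ∑³-const n 1 ⟩
    n ^ 3 ∎
    where
    open ≡-Reasoning
    n = suc s
    inside cuts : ℕ → ℕ → ℕ → ℕ
    inside x y z = 𝟙 (inST s (x , y , z))
    cuts   x y z = cutCorners s (x , y , z)
    cut : ℕ → ℕ
    cut d = 𝟙 (not (s ≤ᵇ 3 * d))
    cutAt : Corner → ℕ → ℕ → ℕ → ℕ
    cutAt v x y z = cut (dist s v (x , y , z))

  cut-threshold : ∀ {r} k → 1 ≤ r → r ≤ 3 → ∀ d → not (r + k * 3 ≤ᵇ 3 * d) ≡ (d ≤ᵇ k)
  cut-threshold {r} k 1≤r r≤3 d =
    det (¬-reflects (≤ᵇ-reflects-≤ (r + k * 3) (3 * d)))
        (fromEquivalence (λ d≤k → <⇒≱ (3d<s (≤ᵇ⇒≤ d k d≤k)))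
                         (λ s≰3d → ≤⇒≤ᵇ (≮⇒≥ (s≰3d ∘ s≤3d))))
    where
    open ≤-Reasoning
    3d<s : d ≤ k → 3 * d < r + k * 3
    3d<s d≤k = begin-strict
      3 * d     ≤⟨ *-monoʳ-≤ 3 d≤k ⟩
      3 * k     ≡⟨ *-comm 3 k ⟩
      k * 3     <⟨ m<n+m (k * 3) 1≤r ⟩
      r + k * 3 ∎
    s≤3d : k < d → r + k * 3 ≤ 3 * d
    s≤3d k<d = begin
      r + k * 3 ≤⟨ +-monoˡ-≤ (k * 3) r≤3 ⟩
      suc k * 3 ≤⟨ *-monoˡ-≤ 3 k<d ⟩
      d * 3     ≡⟨ *-comm d 3 ⟩
      3 * d     ∎

  latticeCount+tetrahedral : ∀ {r} k → 1 ≤ r → r ≤ 3 →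
                     latticeCount (r + k * 3) + 8 * tetrahedral (suc k) ≡ suc (r + k * 3) ^ 3
  latticeCount+tetrahedral {r} k 1≤r r≤3 =
    trans (cong (λ c → latticeCount s + 8 * c) (sym cuts≡simplex)) (latticeCount+cuts s)
    where
    s = r + k * 3
    cuts≡simplex : ∑³ (suc s) (λ x y z → 𝟙 (not (s ≤ᵇ 3 * (x + y + z)))) ≡ tetrahedral (suc k)
    cuts≡simplex = trans (∑³-cong (suc s) {G = λ x y z → 𝟙 (x + y + z ≤ᵇ k)}
                                 λ {x} {y} {z} _ _ _ → cong 𝟙 (cut-threshold k 1≤r r≤3 (x + y + z)))
                         (simplex-count (s≤s (≤-trans (m≤m*n k 3) (m≤n+m (k * 3) r))))

  latticeCount-identity : ∀ {r} k → 1 ≤ r → r ≤ 3 →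
    let s = r + k * 3
        m = s + (3 ∸ r)
    in 81 * latticeCount s + 4 * (m * (m + 3) * (m + 6)) ≡ 81 * (suc s * suc s * suc s)
  latticeCount-identity {r} k 1≤r r≤3 = begin
    81 * L + 4 * (m * (m + 3) * (m + 6))
      ≡⟨ cong (λ m → 81 * L + 4 * (m * (m + 3) * (m + 6))) m≡3[1+k] ⟩
    81 * L + 4 * (3 * suc k * (3 * suc k + 3) * (3 * suc k + 6))
      ≡⟨ cong (81 * L +_) (tetrahedral-scaled k) ⟩
    81 * L + 81 * (8 * tetrahedral (suc k))
      ≡⟨ *-distribˡ-+ 81 L _ ⟨
    81 * (L + 8 * tetrahedral (suc k))
      ≡⟨ cong (81 *_) (latticeCount+tetrahedral k 1≤r r≤3) ⟩
    81 * suc s ^ 3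
      ≡⟨ cong (81 *_) (cube (suc s)) ⟩
    81 * (suc s * suc s * suc s) ∎
    where
    open ≡-Reasoning
    s = r + k * 3
    m = s + (3 ∸ r)
    L = latticeCount s
    m≡3[1+k] : m ≡ 3 * suc k
    m≡3[1+k] = begin
      r + k * 3 + (3 ∸ r)   ≡⟨ cong (_+ (3 ∸ r)) (+-comm r (k * 3)) ⟩
      k * 3 + r + (3 ∸ r)   ≡⟨ +-assoc (k * 3) r (3 ∸ r) ⟩
      k * 3 + (r + (3 ∸ r)) ≡⟨ cong (k * 3 +_) (m+[n∸m]≡n r≤3) ⟩
      k * 3 + 3             ≡⟨ +-comm (k * 3) 3 ⟩
      suc k * 3             ≡⟨ *-comm (suc k) 3 ⟩
      3 * suc k             ∎
    cube : ∀ n → n ^ 3 ≡ n * n * n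
    cube n = trans (cong (λ m → n * (n * m)) (*-identityʳ n)) (sym (*-assoc n n n))

  data Mod3 : ℕ → Set where
    1+3*_ : ∀ k → Mod3 (1 + k * 3)
    2+3*_ : ∀ k → Mod3 (2 + k * 3)
    3+3*_ : ∀ k → Mod3 (3 + k * 3)

  mod3 : ∀ {s} → 1 ≤ s → Mod3 s
  mod3 {1} _ = 1+3* 0
  mod3 {2} _ = 2+3* 0
  mod3 {3} _ = 3+3* 0
  mod3 {suc (suc (suc (suc s)))} _ with mod3 {suc s} z<s
  ... | 1+3* k = 1+3* suc k
  ... | 2+3* k = 2+3* suc k
  ... | 3+3* k = 3+3* suc k

  mod3-mismatch : ∀ r {i} k → r % 3 ≢ i → (r + k * 3) % 3 ≢ i
  mod3-mismatch r k r%3≢i = r%3≢i ∘ trans (sym ([m+kn]%n≡m%n r k 3))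

open LatticePointCount using (Mod3; 1+3*_; 2+3*_; 3+3*_; mod3; mod3-mismatch; latticeCount-identity)

open import Data.Integer using (+_)
open import Data.Rational using (ℚ; _/_; _+_; _-_; _*_)

import Data.Integer as ℤ
import Data.Integer.Properties as ℤ
import Data.Nat as ℕ
open import Data.Empty using (⊥-elim)
open import Data.Nat using (z≤n; s≤s)
open import Data.Nat.Coprimality using (1-coprimeTo) renaming (sym to coprime-sym)
open import Data.Product using (_,_)
open import Data.Rational using (mkℚ; 0ℚ)
open import Data.Rational.Properties using (_≟_; normalize-coprime; /-cong; +-*-commutativeRing)
open import Function using (_∘_; _$_)
open import Relation.Binary.PropositionalEquality using (refl; sym; trans; cong; cong₂; module ≡-Reasoning)
open import Relation.Nullary.Decidable using (dec⇒maybe)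
open import Tactic.RingSolver using (solve-∀)
open import Tactic.RingSolver.Core.AlmostCommutativeRing using (AlmostCommutativeRing; fromCommutativeRing)

ℚ-ring : AlmostCommutativeRing _ _
ℚ-ring = fromCommutativeRing +-*-commutativeRing (dec⇒maybe ∘ (0ℚ ≟_))

ℕtoℚ≡mkℚ : ∀ n → ℕtoℚ n ≡ mkℚ (+ n) 0 (coprime-sym (1-coprimeTo n))
ℕtoℚ≡mkℚ n = normalize-coprime (coprime-sym (1-coprimeTo n))

ℕtoℚ-homo-+ : ∀ m n → ℕtoℚ (m ℕ.+ n) ≡ ℕtoℚ m + ℕtoℚ n
ℕtoℚ-homo-+ m n = trans
  (/-cong (sym (cong₂ ℤ._+_ (ℤ.*-identityʳ (+ m)) (ℤ.*-identityʳ (+ n)))) refl)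
  (sym (cong₂ _+_ (ℕtoℚ≡mkℚ m) (ℕtoℚ≡mkℚ n)))

ℕtoℚ-homo-* : ∀ m n → ℕtoℚ (m ℕ.* n) ≡ ℕtoℚ m * ℕtoℚ n
ℕtoℚ-homo-* m n = trans (/-cong (ℤ.pos-* m n) refl) (sym (cong₂ _*_ (ℕtoℚ≡mkℚ m) (ℕtoℚ≡mkℚ n)))

ℕtoℚ-homo-*³ : ∀ a b c → ℕtoℚ (a ℕ.* b ℕ.* c) ≡ ℕtoℚ a * ℕtoℚ b * ℕtoℚ c
ℕtoℚ-homo-*³ a b c = trans (ℕtoℚ-homo-* (a ℕ.* b) c) (cong (_* ℕtoℚ c) (ℕtoℚ-homo-* a b))

isolate : ∀ X Y Z → ℕtoℚ 81 * X + ℕtoℚ 4 * Y ≡ ℕtoℚ 81 * Z → X ≡ Z - (+ 4 / 81) * Y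
isolate X Y Z eq = begin
  X
    ≡⟨ split X Y ⟩
  (+ 1 / 81) * (ℕtoℚ 81 * X + ℕtoℚ 4 * Y) - (+ 4 / 81) * Y
    ≡⟨ cong (λ u → (+ 1 / 81) * u - (+ 4 / 81) * Y) eq ⟩
  (+ 1 / 81) * (ℕtoℚ 81 * Z) - (+ 4 / 81) * Y
    ≡⟨ cancel Y Z ⟩
  Z - (+ 4 / 81) * Y ∎
  where
  open ≡-Reasoning
  split : ∀ X Y → X ≡ (+ 1 / 81) * (ℕtoℚ 81 * X + ℕtoℚ 4 * Y) - (+ 4 / 81) * Y
  split = solve-∀ ℚ-ring
  cancel : ∀ Y Z → (+ 1 / 81) * (ℕtoℚ 81 * Z) - (+ 4 / 81) * Y ≡ Z - (+ 4 / 81) * Y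
  cancel = solve-∀ ℚ-ring

latticeCount-ℚ : ∀ {r} k → 1 ℕ.≤ r → r ℕ.≤ 3 →
  let t = ℕtoℚ (r ℕ.+ k ℕ.* 3)
      n = t + ℕtoℚ (3 ℕ.∸ r)
  in ℕtoℚ (latticeCount (r ℕ.+ k ℕ.* 3))
       ≡ (ℕtoℚ 1 + t) * (ℕtoℚ 1 + t) * (ℕtoℚ 1 + t) - (+ 4 / 81) * (n * (n + ℕtoℚ 3) * (n + ℕtoℚ 6))
latticeCount-ℚ {r} k 1≤r r≤3 = isolate (ℕtoℚ L) (n * (n + ℕtoℚ 3) * (n + ℕtoℚ 6)) (N * N * N) $ begin
  ℕtoℚ 81 * ℕtoℚ L + ℕtoℚ 4 * (n * (n + ℕtoℚ 3) * (n + ℕtoℚ 6))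
    ≡⟨ cong₂ _+_ (ℕtoℚ-homo-* 81 L)
                 (trans (ℕtoℚ-homo-* 4 cutFactor) (cong (ℕtoℚ 4 *_) cast-cutFactor)) ⟨
  ℕtoℚ (81 ℕ.* L) + ℕtoℚ (4 ℕ.* cutFactor)
    ≡⟨ ℕtoℚ-homo-+ (81 ℕ.* L) (4 ℕ.* cutFactor) ⟨
  ℕtoℚ (81 ℕ.* L ℕ.+ 4 ℕ.* cutFactor)
    ≡⟨ cong ℕtoℚ (latticeCount-identity k 1≤r r≤3) ⟩
  ℕtoℚ (81 ℕ.* (ℕ.suc s ℕ.* ℕ.suc s ℕ.* ℕ.suc s))
    ≡⟨ trans (ℕtoℚ-homo-* 81 (ℕ.suc s ℕ.* ℕ.suc s ℕ.* ℕ.suc s)) (cong (ℕtoℚ 81 *_) cast-cube) ⟩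
  ℕtoℚ 81 * (N * N * N) ∎
  where
  open ≡-Reasoning
  s = r ℕ.+ k ℕ.* 3
  m = s ℕ.+ (3 ℕ.∸ r)
  cutFactor = m ℕ.* (m ℕ.+ 3) ℕ.* (m ℕ.+ 6)
  L = latticeCount s
  t = ℕtoℚ s
  n = t + ℕtoℚ (3 ℕ.∸ r)
  N = ℕtoℚ 1 + t
  cast-cutFactor : ℕtoℚ cutFactor ≡ n * (n + ℕtoℚ 3) * (n + ℕtoℚ 6)
  cast-cutFactor = begin
    ℕtoℚ cutFactor
      ≡⟨ ℕtoℚ-homo-*³ m (m ℕ.+ 3) (m ℕ.+ 6) ⟩
    ℕtoℚ m * ℕtoℚ (m ℕ.+ 3) * ℕtoℚ (m ℕ.+ 6)
      ≡⟨ cong₂ (λ u v → ℕtoℚ m * u * v) (ℕtoℚ-homo-+ m 3) (ℕtoℚ-homo-+ m 6) ⟩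
    ℕtoℚ m * (ℕtoℚ m + ℕtoℚ 3) * (ℕtoℚ m + ℕtoℚ 6)
      ≡⟨ cong (λ u → u * (u + ℕtoℚ 3) * (u + ℕtoℚ 6)) (ℕtoℚ-homo-+ s (3 ℕ.∸ r)) ⟩
    n * (n + ℕtoℚ 3) * (n + ℕtoℚ 6) ∎
  cast-cube : ℕtoℚ (ℕ.suc s ℕ.* ℕ.suc s ℕ.* ℕ.suc s) ≡ N * N * N
  cast-cube = trans (ℕtoℚ-homo-*³ (ℕ.suc s) (ℕ.suc s) (ℕ.suc s))
                    (cong (λ u → u * u * u) (ℕtoℚ-homo-+ 1 s))

expand₀ : ∀ t → let n = t + ℕtoℚ 0 in
  (ℕtoℚ 1 + t) * (ℕtoℚ 1 + t) * (ℕtoℚ 1 + t) - (+ 4 / 81) * (n * (n + ℕtoℚ 3) * (n + ℕtoℚ 6))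
    ≡ (+ 77 / 81) * t * t * t + (+ 23 / 9) * t * t + (+ 19 / 9) * t + (+ 1 / 1)
expand₀ = solve-∀ ℚ-ring

expand₁ : ∀ t → let n = t + ℕtoℚ 2 in
  (ℕtoℚ 1 + t) * (ℕtoℚ 1 + t) * (ℕtoℚ 1 + t) - (+ 4 / 81) * (n * (n + ℕtoℚ 3) * (n + ℕtoℚ 6))
    ≡ (+ 77 / 81) * t * t * t + (+ 61 / 27) * t * t - (+ 7 / 27) * t - (+ 239 / 81)
expand₁ = solve-∀ ℚ-ring

expand₂ : ∀ t → let n = t + ℕtoℚ 1 in
  (ℕtoℚ 1 + t) * (ℕtoℚ 1 + t) * (ℕtoℚ 1 + t) - (+ 4 / 81) * (n * (n + ℕtoℚ 3) * (n + ℕtoℚ 6))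
    ≡ (+ 77 / 81) * t * t * t + (+ 65 / 27) * t * t + (+ 29 / 27) * t - (+ 31 / 81)
expand₂ = solve-∀ ℚ-ring

-- Stated separately so that it can be proved by matching on Mod3 directly: a with-abstraction
-- over mod3 in mainTheorem9 makes Agda normalise latticeCount s for an open s, which does not finish.
Ehrhart : ℕ → Set
Ehrhart s =
    (s % 3 ≡ 0 → ℕtoℚ (latticeCount s) ≡ (+ 77 / 81) * ℕtoℚ s * ℕtoℚ s * ℕtoℚ s + (+ 23 / 9) * ℕtoℚ s * ℕtoℚ s + (+ 19 / 9) * ℕtoℚ s + (+ 1 / 1))
  × (s % 3 ≡ 1 → ℕtoℚ (latticeCount s) ≡ (+ 77 / 81) * ℕtoℚ s * ℕtoℚ s * ℕtoℚ s + (+ 61 / 27) * ℕtoℚ s * ℕtoℚ s - (+ 7 / 27) * ℕtoℚ s - (+ 239 / 81))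
  × (s % 3 ≡ 2 → ℕtoℚ (latticeCount s) ≡ (+ 77 / 81) * ℕtoℚ s * ℕtoℚ s * ℕtoℚ s + (+ 65 / 27) * ℕtoℚ s * ℕtoℚ s + (+ 29 / 27) * ℕtoℚ s - (+ 31 / 81))

ehrhart : ∀ {s} → Mod3 s → Ehrhart s
ehrhart {s} (1+3* k) =
  ⊥-elim ∘ mod3-mismatch 1 k (λ ()) ,
  (λ _ → trans (latticeCount-ℚ k (s≤s z≤n) (s≤s z≤n)) (expand₁ (ℕtoℚ s))) ,
  ⊥-elim ∘ mod3-mismatch 1 k (λ ())
ehrhart {s} (2+3* k) =
  ⊥-elim ∘ mod3-mismatch 2 k (λ ()) ,
  ⊥-elim ∘ mod3-mismatch 2 k (λ ()) ,
  (λ _ → trans (latticeCount-ℚ k (s≤s z≤n) (s≤s (s≤s z≤n))) (expand₂ (ℕtoℚ s)))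
ehrhart {s} (3+3* k) =
  (λ _ → trans (latticeCount-ℚ k (s≤s z≤n) (s≤s (s≤s (s≤s z≤n)))) (expand₀ (ℕtoℚ s))) ,
  ⊥-elim ∘ mod3-mismatch 3 k (λ ()) ,
  ⊥-elim ∘ mod3-mismatch 3 k (λ ())

mainTheorem9 : (s : ℕ) → s ≥ 1 →
    (s % 3 ≡ 0 → ℕtoℚ (latticeCount s) ≡ (+ 77 / 81) * ℕtoℚ s * ℕtoℚ s * ℕtoℚ s + (+ 23 / 9) * ℕtoℚ s * ℕtoℚ s + (+ 19 / 9) * ℕtoℚ s + (+ 1 / 1))
    × (s % 3 ≡ 1 → ℕtoℚ (latticeCount s) ≡ (+ 77 / 81) * ℕtoℚ s * ℕtoℚ s * ℕtoℚ s + (+ 61 / 27) * ℕtoℚ s * ℕtoℚ s - (+ 7 / 27) * ℕtoℚ s - (+ 239 / 81))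
    × (s % 3 ≡ 2 → ℕtoℚ (latticeCount s) ≡ (+ 77 / 81) * ℕtoℚ s * ℕtoℚ s * ℕtoℚ s + (+ 65 / 27) * ℕtoℚ s * ℕtoℚ s + (+ 29 / 27) * ℕtoℚ s - (+ 31 / 81))
mainTheorem9 s s≥1 = ehrhart (mod3 s≥1)
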